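{- Let $G$ be a connected simple graph with $n$ vertices and maximum degree $\Delta_G\ge 2$. Let $r=\left\lfloor \frac{n-\Delta_G-1}{\Delta_G-1}\right\rfloor$ and $\alpha = n-\Delta_G-1-r(\Delta_G-1)$ (so that $0\le \alpha < \Delta_G-1$). Then $$\mathrm{aut}(G)\leq n\,\alpha!\,\Delta_G!\,[(\Delta_G-1)!]^r.$$
   Context: $\mathrm{aut}(G)$ is the order of the automorphism group of $G$ and $\Delta_G$ its maximum degree. -}

module Defs where

open import Data.Nat using (ℕ; zero; suc; _+_; _*_; _∸_; _^_; _≤_; _!)
open import Data.Bool using (Bool; true; false)
open import Data.Fin using (Fin)
open import Data.Fin.Subset using (Subset; ∣_∣)
open import Data.Vec using (tabulate)
open import Data.List using (List; length)
open import Data.List.Relation.Unary.AllPairs using (AllPairs)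
open import Data.Product using (Σ; ∃; _×_)
open import Relation.Binary.PropositionalEquality using (_≡_; _≢_)
open import Relation.Nullary using (¬_)

record SimpleGraph (n : ℕ) : Set where
  field
    adj   : Fin n → Fin n → Bool
    sym   : ∀ i j → adj i j ≡ adj j i
    irrefl : ∀ i → adj i i ≡ false
open SimpleGraph public

nbhd : ∀ {n} → SimpleGraph n → Fin n → Subset n
nbhd G i = tabulate (adj G i)

degree : ∀ {n} → SimpleGraph n → Fin n → ℕ
degree G i = ∣ nbhd G i ∣

IsMaxDegree : ∀ {n} → SimpleGraph n → ℕ → Set
IsMaxDegree G Δ = (∀ i → degree G i ≤ Δ) × ∃ λ i → degree G i ≡ Δ

data Walk {n : ℕ} (G : SimpleGraph n) : Fin n → Fin n → Set where
  here : ∀ {i} → Walk G i i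
  step : ∀ {i j k} → adj G i j ≡ true → Walk G j k → Walk G i k

Connected : ∀ {n} → SimpleGraph n → Set
Connected G = ∀ i j → Walk G i j

record Automorphism {n : ℕ} (G : SimpleGraph n) : Set where
  field
    to      : Fin n → Fin n
    from    : Fin n → Fin n
    to-from : ∀ i → to (from i) ≡ i
    from-to : ∀ i → from (to i) ≡ i
    pres    : ∀ i j → adj G (to i) (to j) ≡ adj G i j
open Automorphism public

Distinct : ∀ {n} {G : SimpleGraph n} → Automorphism G → Automorphism G → Set
Distinct σ τ = ∃ λ i → to σ i ≢ to τ i

-- aut(G) ≤ b : every list of pairwise distinct automorphisms has length ≤ b
AutBoundedBy : ∀ {n} → SimpleGraph n → ℕ → Set
AutBoundedBy G b = (L : List (Automorphism G)) → AllPairs Distinct L → length L ≤ b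

-- Grow a vertex set P from a vertex v of maximum degree: first v and its Δ neighbours, then
-- repeatedly all neighbours outside P of some p ∈ P. By connectivity P eventually contains every
-- vertex, so an automorphism is determined by its restriction to P. Restrictions are counted one
-- new vertex at a time: v has at most n images, its neighbours at most Δ! arrangements, and the c
-- new neighbours of p at most c!, since they must go to the new neighbours of the image of p.
-- As p already has a neighbour in P, c ≤ Δ - 1, and a product of such c! with Σ c = n - Δ - 1 is
-- at most α! ((Δ - 1)!)^r.
{-# OPTIONS --safe #-}
module Submission where

open import Defs hiding (sym)
open import Data.Nat using (ℕ; zero; suc; _+_; _*_; _∸_; _^_; _≤_; _<_; _/_; _%_; _!; NonZero; s≤s; z≤n; _≤′_; ≤′-refl; ≤′-step; >-nonZero⁻¹)
open import Data.Nat.Properties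
open import Data.Nat.DivMod
open import Data.Bool using (Bool; true; false)
import Data.Bool as Bool
open import Data.Fin using (Fin)
import Data.Fin as Fin
import Data.Fin.Properties as Fin
open import Data.Vec using (count)
import Data.Vec as Vec
open import Data.List using (List; []; _∷_; [_]; _++_; length; map; filter; allFin; tabulate)
open import Data.List.Properties using (length-map; length-tabulate; length-++; filter-notAll; filter-some; map-cong-local; ∷-injective; ≡-dec)
open import Data.List.Membership.Propositional using (_∈_; _∉_; find; lose)
open import Data.List.Membership.Propositional.Properties using (∈-filter⁺; ∈-filter⁻; ∈-map⁻; ∈-allFin; ∈-++⁺ˡ; ∈-++⁺ʳ; ∈-++⁻; ∈-lookup)
open import Data.List.Relation.Binary.Subset.Propositional using (_⊆_)
open import Data.List.Relation.Binary.Subset.Propositional.Properties using (filter-⊆; ∷⁺ʳ)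
open import Data.List.Relation.Binary.Permutation.Propositional using (↭-sym)
open import Data.List.Relation.Binary.Permutation.Propositional.Properties using (∈-resp-↭; shift)
open import Data.List.Relation.Unary.All as All using (All; []; _∷_)
import Data.List.Relation.Unary.All.Properties as All
open import Data.List.Relation.Unary.Any using (here; there; any?)
import Data.List.Relation.Unary.Any as Any
open import Data.List.Relation.Unary.AllPairs as AllPairs using (AllPairs; []; _∷_)
import Data.List.Relation.Unary.AllPairs.Properties as AllPairs
open import Data.List.Relation.Unary.Unique.Propositional using (Unique)
import Data.List.Relation.Unary.Unique.Propositional.Properties as Unique
open import Data.Product using (∃; ∃₂; _×_; _,_; <_,_>; proj₁; proj₂)
open import Data.Sum using (_⊎_; inj₁; inj₂)
open import Function using (_on_; _∘_)
open import Relation.Binary.Definitions using (DecidableEquality)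
open import Relation.Binary.PropositionalEquality hiding ([_])
open import Relation.Nullary using (yes; no; ¬?; contradiction)
open import Relation.Nullary.Decidable using (_×-dec_; decidable-stable)
open import Relation.Unary using (Decidable)
open import Relation.Unary.Properties using (∁?)
open import Algebra.Properties.CommutativeSemigroup *-commutativeSemigroup using (xy∙z≈xz∙y; x∙yz≈y∙xz)
import Algebra.Properties.CommutativeSemigroup +-commutativeSemigroup as +

length-filter+length-filter-∁ : ∀ {A : Set} {P : A → Set} (P? : Decidable P) xs →
  length (filter P? xs) + length (filter (∁? P?) xs) ≡ length xs
length-filter+length-filter-∁ P? [] = refl
length-filter+length-filter-∁ P? (x ∷ xs) with P? x
... | yes _ = cong suc (length-filter+length-filter-∁ P? xs)
... | no _  = trans (+-suc _ _) (cong suc (length-filter+length-filter-∁ P? xs))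

length-filter-tabulate : ∀ {A : Set} {m} (f : A → Bool) (g : Fin m → A) →
  length (filter (λ a → f a Bool.≟ true) (tabulate g)) ≡ count (Bool._≟ true) (Vec.tabulate (f ∘ g))
length-filter-tabulate {m = zero} f g = refl
length-filter-tabulate {m = suc m} f g with f (g Fin.zero)
... | true  = cong suc (length-filter-tabulate f (g ∘ Fin.suc))
... | false = length-filter-tabulate f (g ∘ Fin.suc)

Unique-⊆⇒length≤ : ∀ {A : Set} → DecidableEquality A → ∀ {xs ys : List A} →
  Unique xs → xs ⊆ ys → length xs ≤ length ys
Unique-⊆⇒length≤ _≟_ {[]} _ _ = z≤n
Unique-⊆⇒length≤ _≟_ {x ∷ xs} {ys} (x∉xs ∷ xs!) x∷xs⊆ys =
  ≤-trans (s≤s (Unique-⊆⇒length≤ _≟_ xs! xs⊆ys-x))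
          (filter-notAll ≢x? ys (Any.map (λ x≡y y≢x → y≢x (sym x≡y)) (x∷xs⊆ys (here refl))))
  where
  ≢x? : Decidable (_≢ x)
  ≢x? y = ¬? (y ≟ x)
  xs⊆ys-x : xs ⊆ filter ≢x? ys
  xs⊆ys-x y∈xs = ∈-filter⁺ ≢x? (x∷xs⊆ys (there y∈xs)) (λ y≡x → All.lookup x∉xs y∈xs (sym y≡x))

AtMostValues : {A B : Set} → (A → B) → ℕ → Set
AtMostValues f b = ∀ L → AllPairs (_≢_ on f) L → length L ≤ b

AtMostValuesOnFibres : {A B C : Set} → (A → B) → (A → C) → ℕ → Set
AtMostValuesOnFibres f g m = ∀ x L → All (λ y → f y ≡ f x) L → AllPairs (_≢_ on g) L → length L ≤ m

module _ {A B : Set} where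

  atMostValues-mono : ∀ {f : A → B} {b b′} → b ≤ b′ → AtMostValues f b → AtMostValues f b′
  atMostValues-mono b≤b′ values L L# = ≤-trans (values L L#) b≤b′

  atMostValues-factor : ∀ {C : Set} {f : A → C} {g : A → B} {b} →
    (∀ {x y} → f x ≡ f y → g x ≡ g y) → AtMostValues f b → AtMostValues g b
  atMostValues-factor g-factors values L L# = values L (AllPairs.map (λ g≢ → g≢ ∘ g-factors) L#)

  images-in⇒length≤ : DecidableEquality B → (h : A → B) {L : List A} {C : List B} →
    AllPairs (_≢_ on h) L → All (λ x → h x ∈ C) L → length L ≤ length C
  images-in⇒length≤ _≟_ h {L} {C} L# h[L]∈C =
    subst (_≤ length C) (length-map h L) (Unique-⊆⇒length≤ _≟_ (AllPairs.map⁺ L#) h[L]⊆C)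
    where
    h[L]⊆C : map h L ⊆ C
    h[L]⊆C y∈ with ∈-map⁻ h y∈
    ... | x , x∈L , refl = All.lookup h[L]∈C x∈L

atMostValues-Fin : ∀ {A : Set} {n} (f : A → Fin n) → AtMostValues f n
atMostValues-Fin {n = n} f L L# = subst (length L ≤_) (length-tabulate {n = n} (λ i → i))
  (images-in⇒length≤ Fin._≟_ f L# (All.universal (λ x → ∈-allFin (f x)) L))

module _ {A B C : Set} (_≟_ : DecidableEquality B) {f : A → B} {g : A → C} {m : ℕ}
         (fibres : AtMostValuesOnFibres f g m) where

  private
    distinct-on-fibre : ∀ {c} {L : List A} → All (λ y → f y ≡ c) L →
      AllPairs (_≢_ on < f , g >) L → AllPairs (_≢_ on g) L
    distinct-on-fibre [] [] = []
    distinct-on-fibre (fy≡c ∷ fL≡c) (y# ∷ L#) =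
      All.zipWith (λ (fz≡c , yz≢) g≡ → yz≢ (cong₂ _,_ (trans fy≡c (sym fz≡c)) g≡)) (fL≡c , y#)
      ∷ distinct-on-fibre fL≡c L#

    -- Induction on b: the elements f-equal to the head lie in one fibre, and the others take one f-value fewer.
    distinct-<,>⇒length≤ : ∀ b (L : List A) → AllPairs (_≢_ on < f , g >) L →
      (∀ R → R ⊆ L → AllPairs (_≢_ on f) R → length R ≤ b) → length L ≤ b * m
    distinct-<,>⇒length≤ b [] _ _ = z≤n
    distinct-<,>⇒length≤ zero (x ∷ L) _ values = contradiction (values [ x ] (∷⁺ʳ x (λ ())) ([] ∷ [])) λ ()
    distinct-<,>⇒length≤ (suc b) (x ∷ L) (x# ∷ L#) values = begin
      suc (length L)                    ≡⟨ cong suc (length-filter+length-filter-∁ same? L) ⟨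
      suc (length same + length other)  ≤⟨ +-monoˡ-≤ _ same≤m ⟩
      m + length other                  ≤⟨ +-monoʳ-≤ m other≤bm ⟩
      m + b * m                         ∎
      where
      open ≤-Reasoning
      same? : Decidable (λ y → f y ≡ f x)
      same? y = f y ≟ f x
      same = filter same? L
      other = filter (∁? same?) L
      same≤m : suc (length same) ≤ m
      same≤m = fibres x (x ∷ same) (refl ∷ All.all-filter same? L)
        (distinct-on-fibre (refl ∷ All.all-filter same? L) (All.filter⁺ same? x# ∷ AllPairs.filter⁺ same? L#))
      other≤bm : length other ≤ b * m
      other≤bm = distinct-<,>⇒length≤ b other (AllPairs.filter⁺ (∁? same?) L#) λ R R⊆other R# →
        ≤-pred (values (x ∷ R) (∷⁺ʳ x (filter-⊆ (∁? same?) L ∘ R⊆other))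
          (All.tabulate (λ y∈R fx≡fy → proj₂ (∈-filter⁻ (∁? same?) {xs = L} (R⊆other y∈R)) (sym fx≡fy)) ∷ R#))

  atMostValues-<,> : ∀ {b} → AtMostValues f b → AtMostValues < f , g > (b * m)
  atMostValues-<,> {b} values L L# = distinct-<,>⇒length≤ b L L# (λ R _ → values R)

m!*[k+n]!≤[k+m]!*n! : ∀ {m n} → n ≤ m → ∀ k → m ! * (k + n) ! ≤ (k + m) ! * n !
m!*[k+n]!≤[k+m]!*n! n≤m zero = ≤-refl
m!*[k+n]!≤[k+m]!*n! {m} {n} n≤m (suc k) = begin
  m ! * (suc (k + n) * (k + n) !)   ≡⟨ x∙yz≈y∙xz (m !) (suc (k + n)) ((k + n) !) ⟩
  suc (k + n) * (m ! * (k + n) !)   ≤⟨ *-mono-≤ (s≤s (+-monoʳ-≤ k n≤m)) (m!*[k+n]!≤[k+m]!*n! n≤m k) ⟩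
  suc (k + m) * ((k + m) ! * n !)   ≡⟨ *-assoc (suc (k + m)) ((k + m) !) (n !) ⟨
  suc (k + m) * (k + m) ! * n !     ∎
  where open ≤-Reasoning

m!*n!≤[m+n]! : ∀ m n → m ! * n ! ≤ (m + n) !
m!*n!≤[m+n]! m n = begin
  m ! * n !         ≡⟨ cong (λ x → m ! * x !) (+-identityʳ n) ⟨
  m ! * (n + 0) !   ≤⟨ m!*[k+n]!≤[k+m]!*n! z≤n n ⟩
  (n + m) ! * 1     ≡⟨ trans (*-identityʳ _) (cong _! (+-comm n m)) ⟩
  (m + n) !         ∎
  where open ≤-Reasoning

m!*n!≤o!*[m+n∸o]! : ∀ {m n o} → m ≤ o → n ≤ o → o ≤ m + n → m ! * n ! ≤ o ! * (m + n ∸ o) !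
m!*n!≤o!*[m+n∸o]! {m} {n} {o} m≤o n≤o o≤m+n = begin
  m ! * n !         ≡⟨ cong (λ x → m ! * x !) j+e≡n ⟨
  m ! * (j + e) !   ≤⟨ m!*[k+n]!≤[k+m]!*n! e≤m j ⟩
  (j + m) ! * e !   ≡⟨ cong (λ x → x ! * e !) j+m≡o ⟩
  o ! * e !         ∎
  where
  open ≤-Reasoning
  e = m + n ∸ o
  j = o ∸ m
  e≤m : e ≤ m
  e≤m = m≤n+o⇒m∸n≤o (m + n) o (subst (m + n ≤_) (+-comm m o) (+-monoʳ-≤ m n≤o))
  j+m≡o : j + m ≡ o
  j+m≡o = m∸n+n≡m m≤o
  j+e≡n : j + e ≡ n
  j+e≡n = +-cancelˡ-≡ m _ _ (begin-equality
    m + (j + e)   ≡⟨ +-assoc m j e ⟨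
    m + j + e     ≡⟨ cong (_+ e) (trans (+-comm m j) j+m≡o) ⟩
    o + e         ≡⟨ m+[n∸m]≡n o≤m+n ⟩
    m + n         ∎)

-- (s % D)! (D!)^(s / D) is the largest product ∏ cᵢ! over decompositions s = Σ cᵢ into parts cᵢ ≤ D.
packedFactorial : (D : ℕ) .{{_ : NonZero D}} → ℕ → ℕ
packedFactorial D s = (s % D) ! * (D !) ^ (s / D)

module _ {D : ℕ} .{{_ : NonZero D}} where

  packedFactorial-≡ : ∀ {a} q → a < D → packedFactorial D (a + q * D) ≡ a ! * (D !) ^ q
  packedFactorial-≡ {a} q a<D = cong₂ (λ r k → r ! * (D !) ^ k) remainder quotient
    where
    remainder : (a + q * D) % D ≡ a
    remainder = trans ([m+kn]%n≡m%n a q D) (m<n⇒m%n≡m a<D)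
    quotient : (a + q * D) / D ≡ q
    quotient = begin
      (a + q * D) / D     ≡⟨ +-distrib-/ a (q * D) (subst (_< D) (sym (trans (cong₂ _+_ (m<n⇒m%n≡m a<D) (m*n%n≡0 q D)) (+-identityʳ a))) a<D) ⟩
      a / D + q * D / D   ≡⟨ cong₂ _+_ (m<n⇒m/n≡0 a<D) (m*n/n≡m q D) ⟩
      q                   ∎
      where open ≡-Reasoning

  private
    packedFactorial-*-!-via : ∀ s {c a′} k → a′ < D → (s % D) ! * c ! ≤ a′ ! * (D !) ^ k →
      s + c ≡ a′ + (k + s / D) * D → packedFactorial D s * c ! ≤ packedFactorial D (s + c)
    packedFactorial-*-!-via s {c} {a′} k a′<D chunk s+c≡ = begin
      (s % D) ! * (D !) ^ q * c !     ≡⟨ xy∙z≈xz∙y ((s % D) !) ((D !) ^ q) (c !) ⟩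
      (s % D) ! * c ! * (D !) ^ q     ≤⟨ *-monoˡ-≤ ((D !) ^ q) chunk ⟩
      a′ ! * (D !) ^ k * (D !) ^ q    ≡⟨ *-assoc (a′ !) _ _ ⟩
      a′ ! * ((D !) ^ k * (D !) ^ q)  ≡⟨ cong (a′ ! *_) (^-distribˡ-+-* (D !) k q) ⟨
      a′ ! * (D !) ^ (k + q)          ≡⟨ packedFactorial-≡ (k + q) a′<D ⟨
      packedFactorial D (a′ + (k + q) * D) ≡⟨ cong (packedFactorial D) s+c≡ ⟨
      packedFactorial D (s + c)       ∎
      where
      open ≤-Reasoning
      q = s / D

  packedFactorial-*-! : ∀ s {c} → c ≤ D → packedFactorial D s * c ! ≤ packedFactorial D (s + c)
  packedFactorial-*-! s {c} c≤D with s % D + c <? D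
  ... | yes a+c<D = packedFactorial-*-!-via s 0 a+c<D
                      (≤-trans (m!*n!≤[m+n]! a c) (≤-reflexive (sym (*-identityʳ _)))) s+c≡
    where
    a = s % D
    s+c≡ : s + c ≡ a + c + s / D * D
    s+c≡ = trans (cong (_+ c) (m≡m%n+[m/n]*n s D)) (+.xy∙z≈xz∙y a (s / D * D) c)
  ... | no a+c≮D = packedFactorial-*-!-via s 1 e<D
                     (≤-trans (m!*n!≤o!*[m+n∸o]! (<⇒≤ a<D) c≤D D≤a+c)
                              (≤-reflexive (trans (*-comm (D !) (e !)) (cong (e ! *_) (sym (*-identityʳ (D !)))))))
                     s+c≡
    where
    a = s % D
    a<D = m%n<n s D
    D≤a+c = ≮⇒≥ a+c≮D
    e = a + c ∸ D
    e<D : e < D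
    e<D = subst (e <_) (m+n∸n≡m D D) (∸-monoˡ-< (+-mono-<-≤ a<D c≤D) D≤a+c)
    s+c≡ : s + c ≡ e + (D + s / D * D)
    s+c≡ = begin
      s + c                  ≡⟨ cong (_+ c) (m≡m%n+[m/n]*n s D) ⟩
      a + s / D * D + c      ≡⟨ +.xy∙z≈xz∙y a (s / D * D) c ⟩
      a + c + s / D * D      ≡⟨ cong (_+ s / D * D) (trans (sym (m+[n∸m]≡n D≤a+c)) (+-comm D e)) ⟩
      e + D + s / D * D      ≡⟨ +-assoc e D (s / D * D) ⟩
      e + (D + s / D * D)    ∎
      where open ≡-Reasoning

  packedFactorial-≤-suc : ∀ s → packedFactorial D s ≤ packedFactorial D (suc s)
  packedFactorial-≤-suc s = begin
    packedFactorial D s           ≡⟨ *-identityʳ _ ⟨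
    packedFactorial D s * 1 !     ≤⟨ packedFactorial-*-! s (>-nonZero⁻¹ D) ⟩
    packedFactorial D (s + 1)     ≡⟨ cong (packedFactorial D) (+-comm s 1) ⟩
    packedFactorial D (suc s)     ∎
    where open ≤-Reasoning

  packedFactorial-mono-≤′ : ∀ {s t} → s ≤′ t → packedFactorial D s ≤ packedFactorial D t
  packedFactorial-mono-≤′ ≤′-refl = ≤-refl
  packedFactorial-mono-≤′ (≤′-step s≤′t) = ≤-trans (packedFactorial-mono-≤′ s≤′t) (packedFactorial-≤-suc _)

module _ {n : ℕ} (G : SimpleGraph n) where

  open import Data.List.Membership.DecPropositional (Fin._≟_ {n}) using (_∈?_; _∉?_)

  neighbours : Fin n → List (Fin n)
  neighbours p = filter (λ y → adj G p y Bool.≟ true) (allFin n)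

  ∈-neighbours⁺ : ∀ {p y} → adj G p y ≡ true → y ∈ neighbours p
  ∈-neighbours⁺ {p} {y} p~y = ∈-filter⁺ (λ y → adj G p y Bool.≟ true) (∈-allFin y) p~y

  ∈-neighbours⁻ : ∀ {p y} → y ∈ neighbours p → adj G p y ≡ true
  ∈-neighbours⁻ {p} y∈ = proj₂ (∈-filter⁻ (λ y → adj G p y Bool.≟ true) {xs = allFin n} y∈)

  neighbours-unique : ∀ p → Unique (neighbours p)
  neighbours-unique p = Unique.filter⁺ _ (Unique.allFin⁺ n)

  length-neighbours : ∀ p → length (neighbours p) ≡ degree G p
  length-neighbours p = length-filter-tabulate (adj G p) (λ i → i)

  ∉-neighbours-self : ∀ p → p ∉ neighbours p
  ∉-neighbours-self p p∈N = contradiction (trans (sym (∈-neighbours⁻ p∈N)) (irrefl G p)) λ ()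

  record NewNeighbours (p : Fin n) (P Q : List (Fin n)) : Set where
    field
      unique   : Unique Q
      sound    : ∀ {y} → y ∈ Q → adj G p y ≡ true × y ∉ P
      complete : ∀ {y} → adj G p y ≡ true → y ∉ P → y ∈ Q

  newNeighbours : Fin n → List (Fin n) → List (Fin n)
  newNeighbours p P = filter (_∉? P) (neighbours p)

  newNeighbours-spec : ∀ p P → NewNeighbours p P (newNeighbours p P)
  newNeighbours-spec p P = record
    { unique   = Unique.filter⁺ (_∉? P) (neighbours-unique p)
    ; sound    = λ y∈ → let y∈N , y∉P = ∈-filter⁻ (_∉? P) {xs = neighbours p} y∈ in ∈-neighbours⁻ y∈N , y∉P
    ; complete = λ p~y y∉P → ∈-filter⁺ (_∉? P) (∈-neighbours⁺ p~y) y∉P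
    }

  neighbours-new : ∀ p → NewNeighbours p [ p ] (neighbours p)
  neighbours-new p = record
    { unique   = neighbours-unique p
    ; sound    = λ y∈N → ∈-neighbours⁻ y∈N , λ { (here refl) → ∉-neighbours-self p y∈N }
    ; complete = λ p~y _ → ∈-neighbours⁺ p~y
    }

  length-newNeighbours< : ∀ {p P q} → q ∈ P → adj G p q ≡ true → length (newNeighbours p P) < degree G p
  length-newNeighbours< {p} {P} q∈P p~q = subst (length (newNeighbours p P) <_) (length-neighbours p)
    (filter-notAll (_∉? P) (neighbours p) (Any.map (λ { refl q∉P → q∉P q∈P }) (∈-neighbours⁺ p~q)))

  length-newNeighbours>0 : ∀ {p P y} → adj G p y ≡ true → y ∉ P → 0 < length (newNeighbours p P)
  length-newNeighbours>0 {P = P} p~y y∉P = filter-some (_∉? P) (lose (∈-neighbours⁺ p~y) y∉P)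

  newNeighbours-∷ : ∀ {p P q Q} → NewNeighbours p P (q ∷ Q) → NewNeighbours p (q ∷ P) Q
  newNeighbours-∷ {P = P} {q} {Q} new = record
    { unique   = AllPairs.tail unique
    ; sound    = λ y∈Q → proj₁ (sound (there y∈Q)) , λ
        { (here refl) → All.lookup (AllPairs.head unique) y∈Q refl
        ; (there y∈P) → proj₂ (sound (there y∈Q)) y∈P }
    ; complete = λ p~y y∉q∷P → tail-of (complete p~y (y∉q∷P ∘ there)) y∉q∷P
    }
    where
    open NewNeighbours new
    tail-of : ∀ {y} → y ∈ q ∷ Q → y ∉ q ∷ P → y ∈ Q
    tail-of (here refl) y∉q∷P = contradiction (here refl) y∉q∷P
    tail-of (there y∈Q) _     = y∈Q

  Closed : List (Fin n) → Set
  Closed P = ∀ {p y} → p ∈ P → adj G p y ≡ true → y ∈ P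

  closed⊎exit : ∀ P → Closed P ⊎ ∃₂ λ p y → p ∈ P × adj G p y ≡ true × y ∉ P
  closed⊎exit P with any? (λ p → any? (λ y → (adj G p y Bool.≟ true) ×-dec (y ∉? P)) (allFin n)) P
  ... | yes exit = let p , p∈P , exit-p = find exit ; y , _ , p~y , y∉P = find exit-p in
                   inj₂ (p , y , p∈P , p~y , y∉P)
  ... | no ¬exit = inj₁ λ {p} {y} p∈P p~y →
                   decidable-stable (y ∈? P) λ y∉P → ¬exit (lose p∈P (lose (∈-allFin y) (p~y , y∉P)))

  walk-closed : ∀ {P i j} → Closed P → Walk G i j → i ∈ P → j ∈ P
  walk-closed closed here i∈P = i∈P
  walk-closed closed (step i~k w) i∈P = walk-closed closed w (closed i∈P i~k)

  to-injective : ∀ (σ : Automorphism G) {x y} → to σ x ≡ to σ y → x ≡ y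
  to-injective σ {x} {y} eq = trans (sym (from-to σ x)) (trans (cong (from σ) eq) (from-to σ y))

  from-injective : ∀ (σ : Automorphism G) {x y} → from σ x ≡ from σ y → x ≡ y
  from-injective σ {x} {y} eq = trans (sym (to-from σ x)) (trans (cong (to σ) eq) (to-from σ y))

  restrict : List (Fin n) → Automorphism G → List (Fin n)
  restrict P σ = map (to σ) P

  restrict-≡⇒agree : ∀ σ τ {P y} → restrict P σ ≡ restrict P τ → y ∈ P → to σ y ≡ to τ y
  restrict-≡⇒agree σ τ eq (here refl)  = proj₁ (∷-injective eq)
  restrict-≡⇒agree σ τ eq (there y∈P) = restrict-≡⇒agree σ τ (proj₂ (∷-injective eq)) y∈P

  atMostValues-restrict-⊆ : ∀ {P P′ b} → P ⊆ P′ → AtMostValues (restrict P′) b → AtMostValues (restrict P) b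
  atMostValues-restrict-⊆ P⊆P′ = atMostValues-factor λ {σ} {τ} eq →
    map-cong-local (All.tabulate (λ y∈P → restrict-≡⇒agree σ τ eq (P⊆P′ y∈P)))

  atMostValues-restrict-∷ : ∀ {P x b m} → AtMostValues (restrict P) b →
    AtMostValuesOnFibres (restrict P) (λ σ → to σ x) m → AtMostValues (restrict (x ∷ P)) (b * m)
  atMostValues-restrict-∷ values fibres =
    atMostValues-factor (λ eq → cong₂ _∷_ (cong proj₂ eq) (cong proj₁ eq))
      (atMostValues-<,> (≡-dec Fin._≟_) fibres values)

  -- An automorphism σ agreeing with τ on P sends the neighbour x of p ∈ P to τ y for a neighbour y of p outside P.
  atMostValuesOnFibres-neighbour : ∀ {p x P C} → p ∈ P → adj G p x ≡ true → x ∉ P →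
    (∀ {y} → adj G p y ≡ true → y ∉ P → y ∈ C) →
    AtMostValuesOnFibres (restrict P) (λ σ → to σ x) (length C)
  atMostValuesOnFibres-neighbour {p} {x} {P} {C} p∈P p~x x∉P candidates τ L fibre L# =
    images-in⇒length≤ Fin._≟_ (λ σ → from τ (to σ x))
      (AllPairs.map (λ σx≢σ′x eq → σx≢σ′x (from-injective τ eq)) L#) (All.map (λ {σ} → candidate {σ}) fibre)
    where
    candidate : ∀ {σ} → restrict P σ ≡ restrict P τ → from τ (to σ x) ∈ C
    candidate {σ} σ|P≡τ|P = candidates p~y y∉P
      where
      open ≡-Reasoning
      y = from τ (to σ x)
      p~y : adj G p y ≡ true
      p~y = begin
        adj G p y                ≡⟨ pres τ p y ⟨
        adj G (to τ p) (to τ y)  ≡⟨ cong₂ (adj G) (sym (restrict-≡⇒agree σ τ σ|P≡τ|P p∈P)) (to-from τ (to σ x)) ⟩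
        adj G (to σ p) (to σ x)  ≡⟨ pres σ p x ⟩
        adj G p x                ≡⟨ p~x ⟩
        true                     ∎
      y∉P : y ∉ P
      y∉P y∈P = x∉P (subst (_∈ P) (to-injective σ (trans (restrict-≡⇒agree σ τ σ|P≡τ|P y∈P) (to-from τ (to σ x)))) y∈P)

  atMostValues-restrict-++ : ∀ {p P Q b} → p ∈ P → NewNeighbours p P Q →
    AtMostValues (restrict P) b → AtMostValues (restrict (Q ++ P)) (b * length Q !)
  atMostValues-restrict-++ {Q = []} {b} _ _ values = atMostValues-mono (≤-reflexive (sym (*-identityʳ b))) values
  atMostValues-restrict-++ {p} {P} {q ∷ Q} {b} p∈P new values =
    atMostValues-restrict-⊆ (∈-resp-↭ (↭-sym (shift q Q P)))
      (atMostValues-mono (≤-reflexive (*-assoc b (suc (length Q)) (length Q !)))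
        (atMostValues-restrict-++ (there p∈P) (newNeighbours-∷ new)
          (atMostValues-restrict-∷ values (atMostValuesOnFibres-neighbour p∈P p~q q∉P complete))))
    where
    open NewNeighbours new
    p~q = proj₁ (sound (here refl))
    q∉P = proj₂ (sound (here refl))

  autBoundedBy-restrict : ∀ {P b} → (∀ i → i ∈ P) → AtMostValues (restrict P) b → AutBoundedBy G b
  autBoundedBy-restrict all∈P values L L# =
    values L (AllPairs.map (λ {σ} {τ} (i , σi≢τi) eq → σi≢τi (restrict-≡⇒agree σ τ eq (all∈P i))) L#)

module Exploration {n : ℕ} (G : SimpleGraph n) {Δ : ℕ} (degree≤Δ : ∀ i → degree G i ≤ Δ)
                   (connected : Connected G) {v : Fin n} (degree-v : degree G v ≡ Δ) (1≤Δ : 1 ≤ Δ)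
                   .{{_ : NonZero (Δ ∸ 1)}} where

  -- By `attached`, every p ∈ P has at most Δ - 1 neighbours outside P.
  record Explored (P : List (Fin n)) : Set where
    field
      unique       : Unique P
      root         : v ∈ P
      attached     : ∀ {z} → z ∈ P → ∃ λ y → y ∈ P × adj G z y ≡ true
      extra        : ℕ
      size         : length P ≡ suc Δ + extra
      restrictions : AtMostValues (restrict G P) (n * Δ ! * packedFactorial (Δ ∸ 1) extra)

  length≤n : ∀ {P} → Unique P → length P ≤ n
  length≤n {P} P! = atMostValues-Fin (λ i → i) P P!

  explored₀ : Explored (neighbours G v ++ [ v ])
  explored₀ = record
    { unique       = Unique.++⁺ (neighbours-unique G v) ([] ∷ []) λ { (v∈N , here refl) → ∉-neighbours-self G v v∈N }
    ; root         = ∈-++⁺ʳ (neighbours G v) (here refl)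
    ; attached     = attached
    ; extra        = 0
    ; size         = size
    ; restrictions = atMostValues-mono (≤-reflexive bound≡)
        (atMostValues-restrict-++ G (here refl) (neighbours-new G v)
          (atMostValues-factor (cong [_]) (atMostValues-Fin (λ σ → to σ v))))
    }
    where
    |N|≡Δ : length (neighbours G v) ≡ Δ
    |N|≡Δ = trans (length-neighbours G v) degree-v
    attached : ∀ {z} → z ∈ neighbours G v ++ [ v ] → ∃ λ y → y ∈ neighbours G v ++ [ v ] × adj G z y ≡ true
    attached {z} z∈ with ∈-++⁻ (neighbours G v) z∈
    ... | inj₁ z∈N = v , ∈-++⁺ʳ (neighbours G v) (here refl) , trans (SimpleGraph.sym G z v) (∈-neighbours⁻ G z∈N)
    ... | inj₂ (here refl) = _ , ∈-++⁺ˡ y∈N , ∈-neighbours⁻ G y∈N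
      where
      y∈N = ∈-lookup {xs = neighbours G v} (Fin.fromℕ< (subst (0 <_) (sym |N|≡Δ) 1≤Δ))
    size : length (neighbours G v ++ [ v ]) ≡ suc Δ + 0
    size = begin
      length (neighbours G v ++ [ v ])  ≡⟨ length-++ (neighbours G v) ⟩
      length (neighbours G v) + 1       ≡⟨ cong (_+ 1) |N|≡Δ ⟩
      Δ + 1                             ≡⟨ +-comm Δ 1 ⟩
      suc Δ                             ≡⟨ +-identityʳ (suc Δ) ⟨
      suc Δ + 0                         ∎
      where open ≡-Reasoning
    bound≡ : n * length (neighbours G v) ! ≡ n * Δ ! * packedFactorial (Δ ∸ 1) 0
    bound≡ = begin
      n * length (neighbours G v) !                ≡⟨ cong (λ d → n * d !) |N|≡Δ ⟩
      n * Δ !                                      ≡⟨ *-identityʳ (n * Δ !) ⟨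
      n * Δ ! * 1                                  ≡⟨ cong (n * Δ ! *_) (packedFactorial-≡ 0 (>-nonZero⁻¹ (Δ ∸ 1))) ⟨
      n * Δ ! * packedFactorial (Δ ∸ 1) 0          ∎
      where open ≡-Reasoning

  grow : ∀ {P p y} → Explored P → p ∈ P → adj G p y ≡ true → y ∉ P → Explored (newNeighbours G p P ++ P)
  grow {P} {p} E p∈P p~y y∉P = record
    { unique       = Unique.++⁺ unique′ unique λ (z∈Q , z∈P) → proj₂ (sound z∈Q) z∈P
    ; root         = ∈-++⁺ʳ Q root
    ; attached     = attached′
    ; extra        = extra + length Q
    ; size         = size′
    ; restrictions = atMostValues-mono bound≤ (atMostValues-restrict-++ G p∈P new restrictions)
    }
    where
    open Explored E
    Q = newNeighbours G p P
    new = newNeighbours-spec G p P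
    open NewNeighbours new renaming (unique to unique′)
    |Q|≤Δ-1 : length Q ≤ Δ ∸ 1
    |Q|≤Δ-1 = let _ , q∈P , p~q = attached p∈P in
      ∸-monoˡ-≤ 1 (≤-trans (length-newNeighbours< G q∈P p~q) (degree≤Δ p))
    bound≤ : n * Δ ! * packedFactorial (Δ ∸ 1) extra * length Q ! ≤ n * Δ ! * packedFactorial (Δ ∸ 1) (extra + length Q)
    bound≤ = ≤-trans (≤-reflexive (*-assoc (n * Δ !) _ _)) (*-monoʳ-≤ (n * Δ !) (packedFactorial-*-! extra |Q|≤Δ-1))
    attached′ : ∀ {z} → z ∈ Q ++ P → ∃ λ y → y ∈ Q ++ P × adj G z y ≡ true
    attached′ {z} z∈ with ∈-++⁻ Q z∈
    ... | inj₁ z∈Q = p , ∈-++⁺ʳ Q p∈P , trans (SimpleGraph.sym G z p) (proj₁ (sound z∈Q))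
    ... | inj₂ z∈P = let y , y∈P , z~y = attached z∈P in y , ∈-++⁺ʳ Q y∈P , z~y
    size′ : length (Q ++ P) ≡ suc Δ + (extra + length Q)
    size′ = begin
      length (Q ++ P)                 ≡⟨ length-++ Q ⟩
      length Q + length P             ≡⟨ cong (length Q +_) size ⟩
      length Q + (suc Δ + extra)      ≡⟨ +-comm (length Q) _ ⟩
      suc Δ + extra + length Q        ≡⟨ +-assoc (suc Δ) extra (length Q) ⟩
      suc Δ + (extra + length Q)      ∎
      where open ≡-Reasoning

  bound : ℕ
  bound = n * Δ ! * packedFactorial (Δ ∸ 1) (n ∸ Δ ∸ 1)

  finish : ∀ {P} → Explored P → Closed G P → AutBoundedBy G bound
  finish E closed = autBoundedBy-restrict G (λ i → walk-closed G closed (connected v i) root)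
    (atMostValues-mono (*-monoʳ-≤ (n * Δ !) (packedFactorial-mono-≤′ (≤⇒≤′ extra≤N))) restrictions)
    where
    open Explored E
    extra≤N : extra ≤ n ∸ Δ ∸ 1
    extra≤N = ∸-monoˡ-≤ 1 (subst (_≤ n ∸ Δ) (m+n∸m≡n Δ (suc extra))
                (∸-monoˡ-≤ Δ (subst (_≤ n) (trans size (sym (+-suc Δ extra))) (length≤n unique))))

  explore : ∀ k {P} → n ≤ k + length P → Explored P → AutBoundedBy G bound
  explore zero {P} n≤|P| E with closed⊎exit G P
  ... | inj₁ closed = finish E closed
  ... | inj₂ (_ , y , _ , _ , y∉P) = contradiction (≤-trans (length≤n y∷P!) n≤|P|) (n≮n _)
    where
    y∷P! : Unique (y ∷ P)
    y∷P! = All.tabulate (λ z∈P y≡z → y∉P (subst (_∈ P) (sym y≡z) z∈P)) ∷ Explored.unique E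
  explore (suc k) {P} n≤1+k+|P| E with closed⊎exit G P
  ... | inj₁ closed = finish E closed
  ... | inj₂ (p , y , p∈P , p~y , y∉P) = explore k n≤k+|Q++P| (grow E p∈P p~y y∉P)
    where
    Q = newNeighbours G p P
    n≤k+|Q++P| : n ≤ k + length (Q ++ P)
    n≤k+|Q++P| = begin
      n                       ≤⟨ n≤1+k+|P| ⟩
      suc k + length P        ≡⟨ +-suc k (length P) ⟨
      k + suc (length P)      ≤⟨ +-monoʳ-≤ k (+-monoˡ-≤ (length P) (length-newNeighbours>0 G p~y y∉P)) ⟩
      k + (length Q + length P) ≡⟨ cong (k +_) (length-++ Q) ⟨
      k + length (Q ++ P)     ∎
      where open ≤-Reasoning

corollary1 : (n : ℕ) (G : SimpleGraph n) (Δ : ℕ) →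
    Connected G → IsMaxDegree G Δ → 2 ≤ Δ →
    .{{_ : NonZero (Δ ∸ 1)}} →
    let r = (n ∸ Δ ∸ 1) / (Δ ∸ 1)
        α = (n ∸ Δ ∸ 1) ∸ r * (Δ ∸ 1)
    in AutBoundedBy G (n * (α !) * (Δ !) * ((Δ ∸ 1) !) ^ r)
corollary1 n G Δ connected (degree≤Δ , v , degree-v) 2≤Δ =
  subst (AutBoundedBy G) bound≡
    (explore n (m≤m+n n _) explored₀)
  where
  open Exploration G degree≤Δ connected degree-v (<⇒≤ 2≤Δ)
  open ≡-Reasoning
  D = Δ ∸ 1
  N = n ∸ Δ ∸ 1
  bound≡ : n * Δ ! * packedFactorial D N ≡ n * (N ∸ N / D * D) ! * Δ ! * (D !) ^ (N / D)
  bound≡ = begin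
    n * Δ ! * ((N % D) ! * (D !) ^ (N / D))              ≡⟨ *-assoc (n * Δ !) _ _ ⟨
    n * Δ ! * (N % D) ! * (D !) ^ (N / D)                ≡⟨ cong (λ a → n * Δ ! * a ! * (D !) ^ (N / D)) (m%n≡m∸m/n*n N D) ⟩
    n * Δ ! * (N ∸ N / D * D) ! * (D !) ^ (N / D)        ≡⟨ cong (_* (D !) ^ (N / D)) (xy∙z≈xz∙y n (Δ !) _) ⟩
    n * (N ∸ N / D * D) ! * Δ ! * (D !) ^ (N / D)        ∎
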